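{- Let $G=(V,E)$ be a finite, simple, undirected, connected bipartite graph. Then $$\rho_c(G) \leq \rho_p(G) \leq \alpha(G) \quad\text{and}\quad ip_c(G) \leq ip_p(G) \leq \alpha(G).$$
   Context: $\alpha(G)$ is the independence number of $G$. Paths are allowed to consist of a single vertex. A path $P$ in $G$ is an induced path if the subgraph of $G$ induced by the vertex set of $P$ is exactly $P$; it is an isometric path if it is a shortest path between its endpoints in $G$. An induced (resp. isometric) path cover of $G$ is a set of induced (resp. isometric) paths such that every vertex of $G$ lies on at least one of them; an induced (resp. isometric) path partition is such a set in which every vertex lies on exactly one of the paths. $\rho_c(G)$ and $ip_c(G)$ denote the minimum cardinality of an induced path cover and of an isometric path cover of $G$; $\rho_p(G)$ and $ip_p(G)$ denote the minimum cardinality of an induced path partition and of an isometric path partition of $G$. -}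

module Defs where

open import Data.Nat using (ℕ; zero; suc; _≤_)
open import Data.Fin using (Fin; toℕ)
open import Data.Bool using (Bool)
open import Data.List using (List; []; _∷_; length; lookup)
open import Data.List.Membership.Propositional using (_∈_)
open import Data.List.Relation.Unary.Linked using (Linked)
open import Data.List.Relation.Unary.Unique.Propositional using (Unique)
open import Data.List.Relation.Unary.All using (All)
open import Data.Product using (Σ; ∃; _×_)
open import Data.Sum using (_⊎_)
open import Relation.Nullary using (¬_)
open import Relation.Binary.PropositionalEquality using (_≡_; _≢_)

record Graph (n : ℕ) : Set₁ where
  field
    Adj     : Fin n → Fin n → Set
    sym     : ∀ {u v} → Adj u v → Adj v u
    irrefl  : ∀ {u} → ¬ Adj u u

module _ {n : ℕ} (G : Graph n) where
  open Graph G

  data Walk : Fin n → Fin n → ℕ → Set where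
    here  : ∀ {u} → Walk u u zero
    step  : ∀ {u w v m} → Adj u w → Walk w v m → Walk u v (suc m)

  Connected : Set
  Connected = ∀ u v → ∃ λ m → Walk u v m

  Bipartite : Set
  Bipartite = Σ (Fin n → Bool) λ c → ∀ u v → Adj u v → c u ≢ c v

  IsIndependentSet : List (Fin n) → Set
  IsIndependentSet S = Unique S × (∀ u v → u ∈ S → v ∈ S → ¬ Adj u v)

  IsPath : List (Fin n) → Set
  IsPath P = (P ≢ []) × Unique P × Linked Adj P

  IsInducedPath : List (Fin n) → Set
  IsInducedPath P = IsPath P ×
    (∀ (i j : Fin (length P)) → Adj (lookup P i) (lookup P j) →
       (toℕ i ≡ suc (toℕ j)) ⊎ (toℕ j ≡ suc (toℕ i)))

  data IsIsometricPath : List (Fin n) → Set where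
    isometric : ∀ u v (P : List (Fin n)) →
      IsPath (u ∷ P) →
      lookup (u ∷ P) (Data.Fin.fromℕ (length P)) ≡ v →
      (∀ m → Walk u v m → length P ≤ m) →
      IsIsometricPath (u ∷ P)

  -- covers / partitions by a family (list) of paths satisfying IsP;
  -- the cardinality of the family is its length
  IsCover : (List (Fin n) → Set) → List (List (Fin n)) → Set
  IsCover IsP Ps = All IsP Ps × (∀ v → ∃ λ (i : Fin (length Ps)) → v ∈ lookup Ps i)

  IsPartition : (List (Fin n) → Set) → List (List (Fin n)) → Set
  IsPartition IsP Ps = All IsP Ps ×
    (∀ v → ∃ λ (i : Fin (length Ps)) →
       (v ∈ lookup Ps i) × (∀ j → v ∈ lookup Ps j → j ≡ i))

IsMin : (ℕ → Set) → ℕ → Set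
IsMin P k = P k × (∀ m → P m → k ≤ m)

IsMax : (ℕ → Set) → ℕ → Set
IsMax P k = P k × (∀ m → P m → m ≤ k)

module _ {n : ℕ} (G : Graph n) where
  IsIndependenceNumber : ℕ → Set
  IsIndependenceNumber = IsMax (λ k → Σ (List (Fin n)) λ S → IsIndependentSet G S × length S ≡ k)

  private
    minSize : (List (List (Fin n)) → Set) → ℕ → Set
    minSize Q = IsMin (λ k → Σ (List (List (Fin n))) λ Ps → Q Ps × length Ps ≡ k)

  IsRhoC IsRhoP IsIpC IsIpP : ℕ → Set
  IsRhoC = minSize (IsCover G (IsInducedPath G))
  IsRhoP = minSize (IsPartition G (IsInducedPath G))
  IsIpC  = minSize (IsCover G (IsIsometricPath G))
  IsIpP  = minSize (IsPartition G (IsIsometricPath G))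

-- Take a maximum matching m. Its edges and its unmatched vertices
-- partition V into single vertices and edges, which are induced and isometric paths. Kőnig's
-- argument picks one vertex from each part so that the picks are independent: let L be the colour
-- class of colour true and Z the set of vertices reachable from unmatched vertices of L by
-- m-alternating walks. By maximality Z contains no unmatched vertex outside L, so
-- (Z ∩ L) ∪ (V ∖ (Z ∪ L)) is independent and meets every part exactly once. A maximum matching and
-- the decision of membership in Z are only classically available, which suffices because the
-- inequalities to prove are decidable.
module Submission where

open import Defs
open import Level using (0ℓ)
open import Data.Bool using (Bool; true; false; not)
open import Data.Bool.Properties using (¬-not)
open import Data.Empty using (⊥)
open import Data.Fin using (Fin; zero; suc; _≟_)
open import Data.Fin.Properties using (punchInᵢ≢i)
open import Data.List using (List; []; _∷_; length; lookup; map; filter; allFin)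
open import Data.List.Membership.Propositional using (_∈_)
open import Data.List.Membership.Propositional.Properties using (∈-filter⁺; ∈-allFin; ∈-map⁺; ∈-map⁻; ∈-lookup)
open import Data.List.Properties using (length-map)
open import Data.List.Relation.Binary.Disjoint.Propositional using (Disjoint)
open import Data.List.Relation.Unary.All as All using (All; []; _∷_)
import Data.List.Relation.Unary.All.Properties as All
open import Data.List.Relation.Unary.AllPairs using (AllPairs; []; _∷_)
open import Data.List.Relation.Unary.Any as Any using (Any; here; there)
open import Data.List.Relation.Unary.Linked using ([-]; _∷_)
open import Data.List.Relation.Unary.Unique.Propositional using (Unique)
import Data.List.Relation.Unary.Unique.Propositional.Properties as Unique
open import Data.Maybe using (Maybe; just; nothing)
open import Data.Maybe.Properties using (just-injective)
open import Data.Nat using (ℕ; zero; suc; _+_; _*_; _≤_; _<_; z≤n; s≤s; _≤?_)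
open import Data.Nat.Induction using (<-rec)
open import Data.Nat.Properties
  using (module ≤-Reasoning; ≤-refl; ≤-trans; ≤-reflexive; ≤-pred; ≤∧≢⇒<; +-mono-≤; +-comm; +-identityʳ; *-identityʳ; +-cancelʳ-≡;
         n<1+n; m<n⇒m<1+n; m≤n⇒m≤1+n; <⇒≤; 1+n≰n; +-0-commutativeMonoid)
open import Data.Nat.Tactic.RingSolver using (solve-∀)
open import Data.Product using (Σ; ∃; _×_; _,_; proj₁; proj₂)
open import Data.Sum using (_⊎_; inj₁; inj₂)
open import Data.Vec.Functional using (Vector; removeAt)
open import Effect.Monad using (RawMonad)
open import Relation.Nullary using (¬_; Dec; yes; no; contradiction)
open import Relation.Nullary.Decidable using (decidable-stable; ¬¬-excluded-middle)
open import Relation.Nullary.Negation using (¬¬-Monad; ¬¬-map)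
open import Relation.Binary.PropositionalEquality
  using (_≡_; _≢_; refl; sym; trans; cong; cong₂; subst; module ≡-Reasoning)

open import Algebra.Properties.CommutativeMonoid.Sum +-0-commutativeMonoid
  using (sum; sum-remove; sum-cong-≗)
open RawMonad (¬¬-Monad {0ℓ}) using (pure; _>>=_)

¬¬-maximum : (P : ℕ → Set) (N : ℕ) → P 0 → (∀ k → P k → k ≤ N) → ¬ ¬ ∃ (IsMax P)
¬¬-maximum P zero    p₀ bound = pure (0 , p₀ , bound)
¬¬-maximum P (suc N) p₀ bound = ¬¬-excluded-middle >>= λ where
  (yes pN) → pure (suc N , pN , bound)
  (no ¬pN) → ¬¬-maximum P N p₀ λ k pk →
    ≤-pred (≤∧≢⇒< (bound k pk) λ { refl → ¬pN pk })

¬¬-∀-Fin : ∀ {k} {P : Fin k → Set} → (∀ i → ¬ ¬ P i) → ¬ ¬ (∀ i → P i)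
¬¬-∀-Fin {zero}  h = pure λ ()
¬¬-∀-Fin {suc k} h = do
  p₀ ← h zero
  ps ← ¬¬-∀-Fin (λ i → h (suc i))
  pure λ { zero → p₀ ; (suc i) → ps i }

sum-≤-* : ∀ {k b} (f : Vector ℕ k) → (∀ i → f i ≤ b) → sum f ≤ k * b
sum-≤-* {zero}  f h = z≤n
sum-≤-* {suc k} f h = +-mono-≤ (h zero) (sum-≤-* (λ i → f (suc i)) (λ i → h (suc i)))

sum-update : ∀ {k} (f g : Vector ℕ k) i → (∀ j → j ≢ i → f j ≡ g j) → sum f + g i ≡ sum g + f i
sum-update {suc k} f g i agree = begin
  sum f + g i                          ≡⟨ cong (_+ g i) (sum-remove f) ⟩
  f i + sum (removeAt f i) + g i       ≡⟨ cong (λ s → f i + s + g i)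
                                              (sum-cong-≗ λ j → agree _ (punchInᵢ≢i i j)) ⟩
  f i + sum (removeAt g i) + g i       ≡⟨ swap-outer (f i) _ (g i) ⟩
  g i + sum (removeAt g i) + f i       ≡⟨ cong (_+ f i) (sym (sum-remove g)) ⟩
  sum g + f i                          ∎
  where
  open ≡-Reasoning
  swap-outer : ∀ x y z → x + y + z ≡ z + y + x
  swap-outer = solve-∀

module _ {A : Set} where

  pairwiseDisjoint⇒uniqueIndex : ∀ {v} (Ps : List (List A)) → AllPairs Disjoint Ps → Any (v ∈_) Ps →
    ∃ λ (i : Fin (length Ps)) → v ∈ lookup Ps i × (∀ j → v ∈ lookup Ps j → j ≡ i)
  pairwiseDisjoint⇒uniqueIndex (P ∷ Ps) (P#Ps ∷ _) (here v∈P) =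
    zero , v∈P , λ where
      zero    _    → refl
      (suc j) v∈Pj → contradiction (v∈P , v∈Pj) (All.lookup P#Ps (∈-lookup j))
  pairwiseDisjoint⇒uniqueIndex (P ∷ Ps) (P#Ps ∷ #Ps) (there v∈Ps)
    with i , v∈Pi , unique ← pairwiseDisjoint⇒uniqueIndex Ps #Ps v∈Ps =
    suc i , v∈Pi , λ where
      zero    v∈P  → contradiction (v∈P , v∈Pi) (All.lookup P#Ps (∈-lookup i))
      (suc j) v∈Pj → cong suc (unique j v∈Pj)

  map⁺-onDistinct : ∀ {B : Set} {P : A → Set} {R : B → B → Set} (f : A → B) {xs} →
    (∀ {x y} → P x → P y → x ≢ y → R (f x) (f y)) →
    All P xs → Unique xs → AllPairs R (map f xs)
  map⁺-onDistinct f h []         []           = []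
  map⁺-onDistinct f h (px ∷ pxs) (x∉xs ∷ !xs) =
    All.map⁺ (All.zipWith (λ (py , x≢y) → h px py x≢y) (pxs , x∉xs)) ∷ map⁺-onDistinct f h pxs !xs

module VertexOrEdge {n : ℕ} (G : Graph n) where
  open Graph G

  data IsVertexOrEdge : List (Fin n) → Set where
    vertex : ∀ v → IsVertexOrEdge (v ∷ [])
    edge   : ∀ {u v} → Adj u v → IsVertexOrEdge (u ∷ v ∷ [])

  adj⇒≢ : ∀ {u v} → Adj u v → u ≢ v
  adj⇒≢ uv refl = irrefl uv

  vertexOrEdge⇒path : ∀ {P} → IsVertexOrEdge P → IsPath G P
  vertexOrEdge⇒path (vertex v) = (λ ()) , [] ∷ [] , [-]
  vertexOrEdge⇒path (edge uv)  = (λ ()) , (adj⇒≢ uv ∷ []) ∷ [] ∷ [] , uv ∷ [-]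

  vertexOrEdge⇒induced : ∀ {P} → IsVertexOrEdge P → IsInducedPath G P
  vertexOrEdge⇒induced p@(vertex v) = vertexOrEdge⇒path p , λ where
    zero zero vv → contradiction vv irrefl
  vertexOrEdge⇒induced p@(edge uv) = vertexOrEdge⇒path p , λ where
    zero       zero       uu → contradiction uu irrefl
    zero       (suc zero) _  → inj₂ refl
    (suc zero) zero       _  → inj₁ refl
    (suc zero) (suc zero) vv → contradiction vv irrefl

  walk-length≥1 : ∀ {u v m} → u ≢ v → Walk G u v m → 1 ≤ m
  walk-length≥1 u≢v here       = contradiction refl u≢v
  walk-length≥1 u≢v (step _ _) = s≤s z≤n

  vertexOrEdge⇒isometric : ∀ {P} → IsVertexOrEdge P → IsIsometricPath G P
  vertexOrEdge⇒isometric p@(vertex v) = isometric v v [] (vertexOrEdge⇒path p) refl λ _ _ → z≤n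
  vertexOrEdge⇒isometric p@(edge uv)  =
    isometric _ _ (_ ∷ []) (vertexOrEdge⇒path p) refl λ _ → walk-length≥1 (adj⇒≢ uv)

  PartitionAndIndependentSetOfEqualSize : Set
  PartitionAndIndependentSetOfEqualSize = Σ (List (List (Fin n))) λ Ps → Σ (List (Fin n)) λ S →
    IsPartition G IsVertexOrEdge Ps × IsIndependentSet G S × length Ps ≡ length S

module Kőnig {n : ℕ} (G : Graph n) (c : Fin n → Bool) (bip : ∀ u v → Graph.Adj G u v → c u ≢ c v) where
  open Graph G renaming (sym to adj-sym)
  open VertexOrEdge G

  true≢false : true ≢ false
  true≢false ()

  adj⇒colour-flips : ∀ {u v} → Adj u v → c v ≡ not (c u)
  adj⇒colour-flips {u} {v} uv = ¬-not λ e → bip u v uv (sym e)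

  left⇒right : ∀ {u v} → c u ≡ true → Adj u v → c v ≡ false
  left⇒right cu uv = trans (adj⇒colour-flips uv) (cong not cu)

  right⇒left : ∀ {u v} → c u ≡ false → Adj u v → c v ≡ true
  right⇒left cu uv = trans (adj⇒colour-flips uv) (cong not cu)

  Partner : Set
  Partner = Fin n → Maybe (Fin n)

  record IsMatching (m : Partner) : Set where
    field
      partner-sym : ∀ {u v} → m u ≡ just v → m v ≡ just u
      partner-adj : ∀ {u v} → m u ≡ just v → Adj u v
  open IsMatching

  weight : Bool → Maybe (Fin n) → ℕ
  weight true (just _) = 1
  weight _    _        = 0

  -- Counting matched left vertices (colour true) counts every matched edge exactly once.
  size : Partner → ℕ
  size m = sum λ v → weight (c v) (m v)

  size≤n : ∀ m → size m ≤ n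
  size≤n m = ≤-trans (sum-≤-* _ (λ v → weight≤1 (c v) (m v))) (≤-reflexive (*-identityʳ n))
    where
    weight≤1 : ∀ b x → weight b x ≤ 1
    weight≤1 true  (just _) = ≤-refl
    weight≤1 true  nothing  = z≤n
    weight≤1 false _        = z≤n

  unlink : Fin n → Maybe (Fin n) → Maybe (Fin n)
  unlink a nothing  = nothing
  unlink a (just w) with w ≟ a
  ... | yes _ = nothing
  ... | no  _ = just w

  unlink-self : ∀ a → unlink a (just a) ≡ nothing
  unlink-self a with a ≟ a
  ... | yes _   = refl
  ... | no  a≢a = contradiction refl a≢a

  unlink-≢ : ∀ {a w} → w ≢ a → unlink a (just w) ≡ just w
  unlink-≢ {a} {w} w≢a with w ≟ a
  ... | yes w≡a = contradiction w≡a w≢a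
  ... | no  _   = refl

  unlink-just : ∀ {a} x {v} → unlink a x ≡ just v → x ≡ just v × v ≢ a
  unlink-just {a} (just w) e with w ≟ a
  unlink-just (just w) refl | no w≢a = refl , w≢a

  -- Used with b unmatched; the former partner of a becomes unmatched.
  rematch : Fin n → Fin n → Partner → Partner
  rematch a b m v with v ≟ a | v ≟ b
  ... | yes _ | _     = just b
  ... | no  _ | yes _ = just a
  ... | no  _ | no  _ = unlink a (m v)

  module _ {a b : Fin n} {m : Partner} where

    rematch-a : rematch a b m a ≡ just b
    rematch-a with a ≟ a
    ... | yes _   = refl
    ... | no  a≢a = contradiction refl a≢a

    rematch-b : a ≢ b → rematch a b m b ≡ just a
    rematch-b a≢b with b ≟ a | b ≟ b
    ... | yes b≡a | _       = contradiction (sym b≡a) a≢b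
    ... | no  _   | yes _   = refl
    ... | no  _   | no  b≢b = contradiction refl b≢b

    rematch-other : ∀ {v} → v ≢ a → v ≢ b → rematch a b m v ≡ unlink a (m v)
    rematch-other {v} v≢a v≢b with v ≟ a | v ≟ b
    ... | yes v≡a | _       = contradiction v≡a v≢a
    ... | no  _   | yes v≡b = contradiction v≡b v≢b
    ... | no  _   | no  _   = refl

    rematch-isMatching : IsMatching m → m b ≡ nothing → Adj a b → IsMatching (rematch a b m)
    rematch-isMatching M mb≡nothing ab = record { partner-sym = symmetric ; partner-adj = adjacent }
      where
      a≢b = adj⇒≢ ab

      partner≢b : ∀ {u v} → m u ≡ just v → u ≢ b
      partner≢b mu refl with () ← trans (sym mb≡nothing) mu

      symmetric : ∀ {u v} → rematch a b m u ≡ just v → rematch a b m v ≡ just u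
      symmetric {u} {v} e with u ≟ a | u ≟ b
      symmetric refl | yes refl | _        = rematch-b a≢b
      symmetric refl | no  _    | yes refl = rematch-a
      symmetric {u} {v} e | no u≢a | no _ =
        let mu , v≢a = unlink-just (m u) e
            mv = partner-sym M mu
        in trans (rematch-other v≢a (partner≢b mv)) (trans (cong (unlink a) mv) (unlink-≢ u≢a))

      adjacent : ∀ {u v} → rematch a b m u ≡ just v → Adj u v
      adjacent {u} {v} e with u ≟ a | u ≟ b
      adjacent refl | yes refl | _        = ab
      adjacent refl | no  _    | yes refl = adj-sym ab
      adjacent {u} e | no _ | no _ = partner-adj M (proj₁ (unlink-just (m u) e))

    module _ (M : IsMatching m) (ca : c a ≡ true) (ab : Adj a b) (mb≡nothing : m b ≡ nothing) where

      weight-rematch-off : ∀ {v} → v ≢ a → weight (c v) (rematch a b m v) ≡ weight (c v) (m v)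
      weight-rematch-off {v} v≢a = by-cases (v ≟ b)
        where
        weight-unlink : ∀ x → m v ≡ x → weight (c v) (unlink a x) ≡ weight (c v) x
        weight-unlink nothing  _  = refl
        weight-unlink (just w) mv with w ≟ a
        ... | no  _    = refl
        ... | yes refl rewrite left⇒right ca (partner-adj M (partner-sym M mv)) = refl

        by-cases : Dec (v ≡ b) → weight (c v) (rematch a b m v) ≡ weight (c v) (m v)
        by-cases (yes refl) rewrite rematch-b (adj⇒≢ ab) | mb≡nothing | left⇒right ca ab = refl
        by-cases (no v≢b) rewrite rematch-other v≢a v≢b = weight-unlink (m v) refl

      size-rematch : size m + 1 ≡ size (rematch a b m) + weight true (m a)
      size-rematch = begin
        size m + 1                                 ≡⟨ cong (size m +_) (cong₂ weight ca rematch-a) ⟨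
        size m + weight (c a) (rematch a b m a)    ≡⟨ sum-update _ _ a (λ v v≢a → sym (weight-rematch-off v≢a)) ⟩
        size (rematch a b m) + weight (c a) (m a)  ≡⟨ cong (λ x → size (rematch a b m) + weight x (m a)) ca ⟩
        size (rematch a b m) + weight true (m a)   ∎
        where open ≡-Reasoning

      size-augment : m a ≡ nothing → size (rematch a b m) ≡ suc (size m)
      size-augment ma = begin
        size (rematch a b m)                      ≡⟨ +-identityʳ _ ⟨
        size (rematch a b m) + weight true nothing ≡⟨ cong (λ x → size (rematch a b m) + weight true x) ma ⟨
        size (rematch a b m) + weight true (m a)  ≡⟨ size-rematch ⟨
        size m + 1                                ≡⟨ +-comm (size m) 1 ⟩
        suc (size m)                              ∎
        where open ≡-Reasoning

      size-swap : ∀ {b′} → m a ≡ just b′ → size (rematch a b m) ≡ size m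
      size-swap ma = +-cancelʳ-≡ 1 _ _
        (sym (trans size-rematch (cong (λ x → size (rematch a b m) + weight true x) ma)))

  IsMaximum : Partner → Set
  IsMaximum m = IsMatching m × (∀ m′ → IsMatching m′ → size m′ ≤ size m)

  data Reachable (m : Partner) : ℕ → Fin n → Set where
    start    : ∀ {a} → m a ≡ nothing → c a ≡ true → Reachable m 0 a
    viaEdge  : ∀ {k a b} → Reachable m k a → c a ≡ true → Adj a b → Reachable m (suc k) b
    viaMatch : ∀ {k b a} → Reachable m k b → c b ≡ false → m b ≡ just a → Reachable m (suc k) a

  module _ {a b b′ : Fin n} {m : Partner} (M : IsMatching m) (ma : m a ≡ just b′) (mb≡nothing : m b ≡ nothing)
           (ca : c a ≡ true) (cb : c b ≡ false) where

    reachable-rematch : ∀ {j v} → Reachable m j v → (∀ {i} → i < j → ¬ Reachable m i b′) →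
      Reachable (rematch a b m) j v
    reachable-rematch (start {v} mv cv) _ =
      start (trans (rematch-other v≢a v≢b) (cong (unlink a) mv)) cv
      where
      v≢a : v ≢ a
      v≢a refl with () ← trans (sym ma) mv
      v≢b : v ≢ b
      v≢b refl = true≢false (trans (sym cv) cb)
    reachable-rematch (viaEdge r cx xy) avoid =
      viaEdge (reachable-rematch r λ i<k → avoid (m<n⇒m<1+n i<k)) cx xy
    reachable-rematch (viaMatch {k} {w} {v} r cw mw) avoid =
      viaMatch (reachable-rematch r λ i<k → avoid (m<n⇒m<1+n i<k)) cw
        (trans (rematch-other w≢a w≢b) (trans (cong (unlink a) mw) (unlink-≢ v≢a)))
      where
      w≢a : w ≢ a
      w≢a refl = true≢false (trans (sym ca) cw)
      w≢b : w ≢ b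
      w≢b refl with () ← trans (sym mb≡nothing) mw
      v≢a : v ≢ a
      v≢a refl with refl ← just-injective (trans (sym ma) (partner-sym M mw)) = avoid (n<1+n k) r

  NoAugmentingWalk : ℕ → Set
  NoAugmentingWalk k = ∀ {m b} → IsMaximum m → Reachable m k b → c b ≡ false → m b ≡ nothing → ⊥

  -- Instead of flipping the whole walk: if its last left vertex a is unmatched, adding the last edge
  -- enlarges m; otherwise rematching a to the end keeps m maximum, and the old partner of a becomes
  -- an unmatched end of a shorter walk.
  maximum⇒noAugmentingWalk : ∀ k → NoAugmentingWalk k
  maximum⇒noAugmentingWalk = <-rec NoAugmentingWalk shorten
    where
    shorten : ∀ k → (∀ {j} → j < k → NoAugmentingWalk j) → NoAugmentingWalk k
    shorten _ _ _ (start _ cb) cb′ _ = true≢false (trans (sym cb) cb′)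
    shorten _ _ (M , _) (viaMatch _ _ mw) _ mb with () ← trans (sym mb) (partner-sym M mw)
    shorten _ _ _ (viaEdge (viaEdge _ ca′ a′a) ca _) _ _ = true≢false (trans (sym ca) (left⇒right ca′ a′a))
    shorten _ _ (M , maximal) (viaEdge (start ma _) ca ab) _ mb =
      1+n≰n (subst (_≤ _) (size-augment M ca ab mb ma) (maximal _ (rematch-isMatching M mb ab)))
    shorten _ shorter {m} {b} (M , maximal) (viaEdge {a = a} (viaMatch {k} {b′} r cb′ mb′) ca ab) cb mb =
      b′-unreachable k ≤-refl r
      where
      ma = partner-sym M mb′

      maximum′ : IsMaximum (rematch a b m)
      maximum′ = rematch-isMatching M mb ab ,
        λ m″ M″ → ≤-trans (maximal m″ M″) (≤-reflexive (sym (size-swap M ca ab mb ma)))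

      b′≢a : b′ ≢ a
      b′≢a refl = adj⇒≢ (partner-adj M ma) refl
      b′≢b : b′ ≢ b
      b′≢b refl with () ← trans (sym mb) mb′

      m′b′ : rematch a b m b′ ≡ nothing
      m′b′ = trans (rematch-other b′≢a b′≢b) (trans (cong (unlink a) mb′) (unlink-self a))

      b′-unreachable : ∀ j → j ≤ k → ¬ Reachable m j b′
      b′-unreachable = <-rec (λ j → j ≤ k → ¬ Reachable m j b′) λ j shorter′ j≤k r′ →
        shorter (s≤s (m≤n⇒m≤1+n j≤k)) maximum′
          (reachable-rematch M ma mb ca cb r′ λ i<j → shorter′ i<j (≤-trans (<⇒≤ i<j) j≤k)) cb′ m′b′

  Reached : Partner → Fin n → Set
  Reached m v = ∃ λ k → Reachable m k v

  module Transversal {m : Partner} (maximum : IsMaximum m) (reached? : ∀ v → Dec (Reached m v)) where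
    M : IsMatching m
    M = proj₁ maximum

    data Key (k : Fin n) : Set where
      unmatched : m k ≡ nothing → Key k
      left      : c k ≡ true → Key k

    key? : ∀ k → Dec (Key k)
    key? k with m k in mk | c k in ck
    ... | nothing | _     = yes (unmatched mk)
    ... | just _  | true  = yes (left ck)
    ... | just _  | false = no λ where
      (unmatched mk′) → contradiction (trans (sym mk) mk′) λ ()
      (left ck′)      → true≢false (trans (sym ck′) ck)

    piece : Fin n → List (Fin n)
    piece k with m k
    ... | nothing = k ∷ []
    ... | just w  = k ∷ w ∷ []

    keyOf : Fin n → Fin n
    keyOf v with c v | m v
    ... | true  | _       = v
    ... | false | nothing = v
    ... | false | just w  = w

    representative : Fin n → Fin n
    representative k with m k
    ... | nothing = k
    ... | just w with reached? w
    ...   | yes _ = k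
    ...   | no  _ = w

    key-matched⇒left : ∀ {k w} → Key k → m k ≡ just w → c k ≡ true
    key-matched⇒left (unmatched mk′) mk with () ← trans (sym mk′) mk
    key-matched⇒left (left ck)       _  = ck

    keyOf-key : ∀ {k} → Key k → keyOf k ≡ k
    keyOf-key {k} key with c k in ck | m k in mk
    ... | true  | _      = refl
    ... | false | nothing = refl
    ... | false | just _ = contradiction (trans (sym ck) (key-matched⇒left key mk)) λ ()

    keyOf-partner : ∀ {v w} → c w ≡ true → m w ≡ just v → keyOf v ≡ w
    keyOf-partner cw mw rewrite left⇒right cw (partner-adj M mw) | partner-sym M mw = refl

    keyOf-piece : ∀ {k u} → Key k → u ∈ piece k → keyOf u ≡ k
    keyOf-piece {k} key u∈ with m k in mk
    keyOf-piece key (here refl)         | nothing = keyOf-key key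
    keyOf-piece key (here refl)         | just _  = keyOf-key key
    keyOf-piece key (there (here refl)) | just _  = keyOf-partner (key-matched⇒left key mk) mk

    self∈piece : ∀ k → k ∈ piece k
    self∈piece k with m k
    ... | nothing = here refl
    ... | just _  = here refl

    partner∈piece : ∀ {v w} → m w ≡ just v → v ∈ piece w
    partner∈piece {w = w} mw with m w
    partner∈piece refl | just _ = there (here refl)

    piece-keyOf : ∀ v → Key (keyOf v) × v ∈ piece (keyOf v)
    piece-keyOf v with c v in cv | m v in mv
    ... | true  | _       = left cv , self∈piece v
    ... | false | nothing = unmatched mv , self∈piece v
    ... | false | just _  = left (right⇒left cv (partner-adj M mv)) , partner∈piece (partner-sym M mv)

    representative∈piece : ∀ k → representative k ∈ piece k
    representative∈piece k with m k
    ... | nothing = here refl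
    ... | just w with reached? w
    ...   | yes _ = here refl
    ...   | no  _ = there (here refl)

    piece-isVertexOrEdge : ∀ k → IsVertexOrEdge (piece k)
    piece-isVertexOrEdge k with m k in mk
    ... | nothing = vertex k
    ... | just _  = edge (partner-adj M mk)

    -- The complement of a Kőnig vertex cover: reached left vertices and unreached right vertices.
    Chosen : Fin n → Set
    Chosen v = (c v ≡ true × Reached m v) ⊎ (c v ≡ false × ¬ Reached m v)

    representative-chosen : ∀ {k} → Key k → Chosen (representative k)
    representative-chosen {k} key with m k in mk
    ... | nothing with c k in ck
    ...   | true  = inj₁ (refl , 0 , start mk ck)
    ...   | false = inj₂ (refl , λ (j , r) → maximum⇒noAugmentingWalk j maximum r ck mk)
    representative-chosen {k} key | just w with reached? w
    ...   | yes (j , r) = inj₁ (ck , suc j , viaMatch r (left⇒right ck (partner-adj M mk)) (partner-sym M mk))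
      where ck = key-matched⇒left key mk
    ...   | no ¬r = inj₂ (left⇒right (key-matched⇒left key mk) (partner-adj M mk) , ¬r)

    chosen-independent : ∀ {u v} → Chosen u → Chosen v → ¬ Adj u v
    chosen-independent {u} {v} (inj₁ (cu , _)) (inj₁ (cv , _)) uv = bip u v uv (trans cu (sym cv))
    chosen-independent {u} {v} (inj₂ (cu , _)) (inj₂ (cv , _)) uv = bip u v uv (trans cu (sym cv))
    chosen-independent (inj₁ (cu , j , r)) (inj₂ (_ , ¬r)) uv = ¬r (suc j , viaEdge r cu uv)
    chosen-independent (inj₂ (_ , ¬r)) (inj₁ (cv , j , r)) uv = ¬r (suc j , viaEdge r cv (adj-sym uv))

    keys : List (Fin n)
    keys = filter key? (allFin n)

    pieces : List (List (Fin n))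
    pieces = map piece keys

    transversal : List (Fin n)
    transversal = map representative keys

    all-keys : All Key keys
    all-keys = All.all-filter key? (allFin n)

    unique-keys : Unique keys
    unique-keys = Unique.filter⁺ key? (Unique.allFin⁺ n)

    pieces-disjoint : AllPairs Disjoint pieces
    pieces-disjoint = map⁺-onDistinct piece
      (λ kx ky x≢y (u∈x , u∈y) → x≢y (trans (sym (keyOf-piece kx u∈x)) (keyOf-piece ky u∈y)))
      all-keys unique-keys

    pieces-partition : IsPartition G IsVertexOrEdge pieces
    pieces-partition =
      All.map⁺ (All.tabulate λ {k} _ → piece-isVertexOrEdge k) ,
      λ v → let key , v∈piece = piece-keyOf v in
        pairwiseDisjoint⇒uniqueIndex pieces pieces-disjoint
          (Any.map (λ e → subst (v ∈_) e v∈piece) (∈-map⁺ piece (∈-filter⁺ key? (∈-allFin _) key)))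

    transversal-independent : IsIndependentSet G transversal
    transversal-independent =
      map⁺-onDistinct representative
        (λ kx ky x≢y e → x≢y (trans (sym (keyOf-piece kx (representative∈piece _)))
                                (trans (cong keyOf e) (keyOf-piece ky (representative∈piece _)))))
        all-keys unique-keys ,
      λ u v u∈ v∈ → chosen-independent (chosen u∈) (chosen v∈)
      where
      chosen : ∀ {u} → u ∈ transversal → Chosen u
      chosen u∈ with k , k∈ , refl ← ∈-map⁻ representative u∈ = representative-chosen (All.lookup all-keys k∈)

    length-pieces : length pieces ≡ length transversal
    length-pieces = trans (length-map piece keys) (sym (length-map representative keys))

  ¬¬-maximumMatching : ¬ ¬ ∃ IsMaximum
  ¬¬-maximumMatching = do
    (_ , (m , M , s≤size) , greatest) ←
      ¬¬-maximum AttainedSize n (_ , empty , z≤n) λ _ (m , _ , s≤size) → ≤-trans s≤size (size≤n m)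
    pure (m , M , λ m′ M′ → ≤-trans (greatest _ (m′ , M′ , ≤-refl)) s≤size)
    where
    AttainedSize : ℕ → Set
    AttainedSize s = ∃ λ m → IsMatching m × s ≤ size m
    empty : IsMatching (λ _ → nothing)
    empty = record { partner-sym = λ () ; partner-adj = λ () }

  ¬¬-partitionAndIndependentSetOfEqualSize : ¬ ¬ PartitionAndIndependentSetOfEqualSize
  ¬¬-partitionAndIndependentSetOfEqualSize = do
    (m , maximum) ← ¬¬-maximumMatching
    reached? ← ¬¬-∀-Fin λ v → ¬¬-excluded-middle
    let open Transversal maximum reached?
    pure (pieces , transversal , pieces-partition , transversal-independent , length-pieces)

module _ {n : ℕ} (G : Graph n) (IsP : List (Fin n) → Set) where
  open VertexOrEdge G

  IsMinCoverSize IsMinPartitionSize : ℕ → Set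
  IsMinCoverSize     = IsMin λ k → Σ (List (List (Fin n))) λ Ps → IsCover G IsP Ps × length Ps ≡ k
  IsMinPartitionSize = IsMin λ k → Σ (List (List (Fin n))) λ Ps → IsPartition G IsP Ps × length Ps ≡ k

  partition⇒cover : ∀ {Ps} → IsPartition G IsP Ps → IsCover G IsP Ps
  partition⇒cover (paths , unique) = paths , λ v → proj₁ (unique v) , proj₁ (proj₂ (unique v))

  partition-mono : ∀ {IsQ : List (Fin n) → Set} {Ps} →
    (∀ {P} → IsQ P → IsP P) → IsPartition G IsQ Ps → IsPartition G IsP Ps
  partition-mono Q⇒P (paths , unique) = All.map Q⇒P paths , unique

  minCover≤minPartition : ∀ {k l} → IsMinCoverSize k → IsMinPartitionSize l → k ≤ l
  minCover≤minPartition (_ , least) ((Ps , partition , length≡l) , _) =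
    least _ (Ps , partition⇒cover partition , length≡l)

  minPartition≤independenceNumber : ∀ {α k} → Bipartite G → (∀ {P} → IsVertexOrEdge P → IsP P) →
    IsIndependenceNumber G α → IsMinPartitionSize k → k ≤ α
  minPartition≤independenceNumber {α} {k} (c , bip) vertexOrEdge⇒P (_ , greatest) (_ , least) =
    decidable-stable (k ≤? α)
      (¬¬-map bound (Kőnig.¬¬-partitionAndIndependentSetOfEqualSize G c bip))
    where
    bound : PartitionAndIndependentSetOfEqualSize → k ≤ α
    bound (Ps , S , partition , independent , length≡) = begin
      k          ≤⟨ least _ (Ps , partition-mono vertexOrEdge⇒P partition , refl) ⟩
      length Ps  ≡⟨ length≡ ⟩
      length S   ≤⟨ greatest _ (S , independent , refl) ⟩
      α          ∎
      where open ≤-Reasoning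

theorem4p4 : (n : ℕ) (G : Graph n) → Connected G → Bipartite G →
    (α ρc ρp ipc ipp : ℕ) →
    IsIndependenceNumber G α → IsRhoC G ρc → IsRhoP G ρp → IsIpC G ipc → IsIpP G ipp →
    (ρc ≤ ρp × ρp ≤ α) × (ipc ≤ ipp × ipp ≤ α)
theorem4p4 n G _ bipartite α ρc ρp ipc ipp α-max ρc-min ρp-min ipc-min ipp-min =
  (minCover≤minPartition G (IsInducedPath G) ρc-min ρp-min ,
   minPartition≤independenceNumber G (IsInducedPath G) bipartite vertexOrEdge⇒induced α-max ρp-min) ,
  (minCover≤minPartition G (IsIsometricPath G) ipc-min ipp-min ,
   minPartition≤independenceNumber G (IsIsometricPath G) bipartite vertexOrEdge⇒isometric α-max ipp-min)
  where open VertexOrEdge G
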